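{- Let $n\ge1$. If a 3-permutation $(\sigma,\tau)\in S_n\times S_n$ avoids the pattern $(12,12)$, then the configuration $\Gamma(\sigma,\tau)$ is sparse.
   Context: $S_n$ is the set of permutations of $[n]=\{1,\dots,n\}$. A 3-permutation $(\sigma,\tau)\in S_n\times S_n$ contains the pattern $(12,12)$ if there are indices $i<j$ with $\sigma(i)<\sigma(j)$ and $\tau(i)<\tau(j)$; otherwise it avoids it. For $\sigma\in S_n$ and $i\in[n]$, $r_\sigma(i)=\#\{j: i<j\le n,\ \sigma(j)<\sigma(i)\}$ and $l_\sigma(i)=\#\{j:1\le j<i,\ \sigma(j)>\sigma(i)\}$; $\Gamma(\sigma,\tau)=\{(r_\sigma(i),l_\tau(i)) : i\in[n]\}\subset\mathbb{Z}^2$ (for such $(\sigma,\tau)$ these $n$ points are distinct). Let $T_n=\{(x,y)\in\mathbb{Z}^2: x,y\ge0,\ x+y<n\}$; a configuration of size $n$ is a set of $n$ points of $T_n$. For $a,b\in\mathbb{Z}$ and $k\ge0$, $(a,b)+T_k=\{(x,y)\in\mathbb{Z}^2: x\ge a,\ y\ge b,\ x+y<a+b+k\}$. A configuration $C$ of size $n$ is sparse if for every $1\le k<n$ and every $a,b\in\mathbb{Z}$, $|C\cap((a,b)+T_k)|\le k$. -}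

module Defs where

open import Data.Nat as ℕ using (ℕ; zero; suc)
open import Data.Integer as ℤ using (ℤ; +_)
open import Data.Fin using (Fin; toℕ)
open import Data.Fin.Permutation using (Permutation′; _⟨$⟩ʳ_)
open import Data.Product using (_×_; _,_; Σ-syntax)
open import Data.List using (List; filter; length)
open import Data.List.Relation.Unary.Any using (any?)
open import Data.List.Relation.Unary.All using (all?)
open import Data.Fin using (_<_; _>_)
open import Data.Fin.Properties using (_<?_)
open import Data.Vec.Functional using (Vector)
open import Relation.Nullary using (¬_; Dec; yes; no)
open import Relation.Nullary.Decidable using (¬?; _×-dec_; _→-dec_)
import Data.Fin.Properties
open import Data.Product.Properties using (≡-dec)
open import Relation.Binary.PropositionalEquality using (_≡_)
open import Data.Integer.Properties using () renaming (_≤?_ to _≤ℤ?_; _<?_ to _<ℤ?_; _≟_ to _≟ℤ_)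
open import Data.List.Base using (allFin)

-- S_n: permutations of a set of size n (we use Fin n = {0,…,n-1} for [n])
Perm : ℕ → Set
Perm n = Permutation′ n

Contains1212 : ∀ {n} → Perm n → Perm n → Set
Contains1212 {n} σ τ =
  Σ[ i ∈ Fin n ] Σ[ j ∈ Fin n ] (i < j × (σ ⟨$⟩ʳ i) < (σ ⟨$⟩ʳ j) × (τ ⟨$⟩ʳ i) < (τ ⟨$⟩ʳ j))

Avoids1212 : ∀ {n} → Perm n → Perm n → Set
Avoids1212 σ τ = ¬ Contains1212 σ τ

r : ∀ {n} → Perm n → Fin n → ℕ
r {n} σ i = length (filter (λ j → (i <? j) ×-dec ((σ ⟨$⟩ʳ j) <? (σ ⟨$⟩ʳ i))) (allFin n))

l : ∀ {n} → Perm n → Fin n → ℕ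
l {n} σ i = length (filter (λ j → (j <? i) ×-dec ((σ ⟨$⟩ʳ i) <? (σ ⟨$⟩ʳ j))) (allFin n))

Point : Set
Point = ℤ × ℤ

-- A finite configuration presented as an indexed family of points;
-- the configuration is the SET of its values (its image).
Config : ℕ → Set
Config n = Vector Point n

Γ : ∀ {n} → Perm n → Perm n → Config n
Γ σ τ i = (+ r σ i , + l τ i)

InShiftedT : ℤ → ℤ → ℕ → Point → Set
InShiftedT a b k (x , y) = (a ℤ.≤ x) × (b ℤ.≤ y) × (x ℤ.+ y ℤ.< a ℤ.+ b ℤ.+ + k)

inShiftedT? : ∀ a b k p → Dec (InShiftedT a b k p)
inShiftedT? a b k (x , y) = (a ≤ℤ? x) ×-dec ((b ≤ℤ? y) ×-dec ((x ℤ.+ y) <ℤ? (a ℤ.+ b ℤ.+ + k)))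

_≟P_ : (p q : Point) → Dec (p ≡ q)
_≟P_ = ≡-dec _≟ℤ_ _≟ℤ_

-- i is the first index at which its point occurs (so counting such indices
-- counts distinct points of the image set)
FirstOcc : ∀ {n} → Config n → Fin n → Set
FirstOcc {n} C i = ∀ (j : Fin n) → j < i → ¬ (C j ≡ C i)

firstOcc? : ∀ {n} (C : Config n) i → Dec (FirstOcc C i)
firstOcc? {n} C i = Data.Fin.Properties.all? (λ j → (j <? i) →-dec ¬? (C j ≟P C i))

countIn : ∀ {n} → Config n → ℤ → ℤ → ℕ → ℕ
countIn {n} C a b k =
  length (filter (λ i → firstOcc? C i ×-dec inShiftedT? a b k (C i)) (allFin n))

Sparse : ∀ {n} → Config n → Set
Sparse {n} C = ∀ (k : ℕ) → 1 ℕ.≤ k → k ℕ.< n → ∀ (a b : ℤ) → countIn C a b k ℕ.≤ k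

{-# OPTIONS --safe #-}
module Submission where

-- Let p be the index in the triangle (a,b)+T_k with the largest σ-value. Every other index j in the
-- triangle lies either after p, where σ(j) < σ(p) makes it an inversion counted by r_σ(p), or before p,
-- where avoidance of (12,12) forces τ(j) > τ(p), an inversion counted by l_τ(p). Both kinds of inversion
-- are strict orders whose ranks are r_σ and l_τ, and a rank grows by at least the number of elements
-- below it: if A triangle indices lie after p then r_σ(p) ≥ a + A, and if B lie before p then
-- l_τ(p) ≥ b + B. Since r_σ(p) + l_τ(p) < a + b + k, A + B < k, so the triangle holds at most
-- A + B + 1 ≤ k indices, and a fortiori at most k distinct points.

open import Defs
open import Data.Nat using (ℕ; _≤_)
open import Data.Nat as ℕ using (suc; _+_; s≤s; z≤n)
import Data.Nat.Properties as ℕ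
open import Data.Integer as ℤ using (ℤ; +_)
import Data.Integer.Properties as ℤ
open import Data.Fin as Fin using (Fin; toℕ)
import Data.Fin.Properties as Fin
open import Data.Fin.Permutation using (_⟨$⟩ʳ_)
open import Data.List using ([]; _∷_; filter; length; allFin)
open import Data.List.Properties using (filter-none; filter-some)
open import Data.List.Membership.Propositional.Properties using (∈-filter⁺; ∈-allFin)
open import Data.List.Relation.Unary.All as All using (All; []; _∷_)
open import Data.List.Relation.Unary.All.Properties using (all-filter)
open import Data.List.Relation.Unary.AllPairs using (_∷_)
open import Data.List.Relation.Unary.Unique.Propositional using (Unique)
import Data.List.Relation.Unary.Unique.Propositional.Properties as Unique
open import Data.List.Relation.Binary.Sublist.Propositional using (⊆-refl)
open import Data.List.Relation.Binary.Sublist.Propositional.Properties using (filter⁺; length-mono-≤)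
import Data.List.Extrema ℕ.≤-totalOrder as Extrema
open import Data.Product using (_×_; _,_; proj₁; proj₂; ∃-syntax)
open import Data.Sum using (inj₁; inj₂)
open import Function using (_∘_; id; case_of_)
open import Function.Bundles using (Injection)
open import Function.Properties.Inverse using (↔⇒↣)
open import Level using (Level; 0ℓ)
open import Relation.Nullary using (yes; no; contradiction)
open import Relation.Nullary.Decidable using (_×-dec_)
open import Relation.Unary using (Pred; Decidable; _⊆_; _∪_; _∩_; ∁; ｛_｝; Empty; Satisfiable)
open import Relation.Unary.Properties using (_∩?_; _∪?_; ∁?)
open import Relation.Binary using (Rel; Transitive; Irreflexive; tri<; tri≈; tri>)
import Relation.Binary as B
open import Algebra.Properties.CommutativeSemigroup ℤ.+-commutativeSemigroup using (interchange)
open import Relation.Binary.PropositionalEquality using (_≡_; _≢_; refl; sym; trans; cong)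

private
  variable
    ℓ ℓ₁ ℓ₂ ℓ₃ : Level
    A : Set ℓ

module _ {P : Pred A ℓ₁} {Q : Pred A ℓ₂} (P? : Decidable P) (Q? : Decidable Q) where

  length-filter-∩-∁ : ∀ xs → length (filter P? xs) ≡
                      length (filter (P? ∩? Q?) xs) + length (filter (P? ∩? ∁? Q?) xs)
  length-filter-∩-∁ []       = refl
  length-filter-∩-∁ (x ∷ xs) with ih ← length-filter-∩-∁ xs | P? x | Q? x
  ... | yes _ | yes _ = cong suc ih
  ... | yes _ | no  _ = trans (cong suc ih) (sym (ℕ.+-suc _ _))
  ... | no  _ | _     = ih

unique-constant⇒length≤1 : ∀ {x : A} {xs} → Unique xs → All (_≡ x) xs → length xs ≤ 1
unique-constant⇒length≤1 {xs = []}        _                 _                 = z≤n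
unique-constant⇒length≤1 {xs = _ ∷ []}    _                 _                 = s≤s z≤n
unique-constant⇒length≤1 {xs = _ ∷ _ ∷ _} ((y≢z ∷ _) ∷ _) (refl ∷ refl ∷ _) = contradiction refl y≢z

module _ {n : ℕ} where

  count : {P : Pred (Fin n) ℓ} → Decidable P → ℕ
  count P? = length (filter P? (allFin n))

  module _ {P : Pred (Fin n) ℓ₁} {Q : Pred (Fin n) ℓ₂} (P? : Decidable P) (Q? : Decidable Q) where

    count-mono : P ⊆ Q → count P? ≤ count Q?
    count-mono P⊆Q = length-mono-≤ (filter⁺ P? Q? (λ { refl → P⊆Q }) (⊆-refl {x = allFin n}))

    count-∩-∁ : count P? ≡ count (P? ∩? Q?) + count (P? ∩? ∁? Q?)
    count-∩-∁ = length-filter-∩-∁ P? Q? (allFin n)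

  module _ {P : Pred (Fin n) ℓ₁} {Q : Pred (Fin n) ℓ₂} {R : Pred (Fin n) ℓ₃}
           (P? : Decidable P) (Q? : Decidable Q) (R? : Decidable R) where

    count-≤-+ : P ⊆ Q ∪ R → count P? ≤ count Q? + count R?
    count-≤-+ P⊆Q∪R = begin
      count P?                                ≡⟨ count-∩-∁ P? Q? ⟩
      count (P? ∩? Q?) + count (P? ∩? ∁? Q?)  ≤⟨ ℕ.+-mono-≤ (count-mono _ Q? proj₂) (count-mono _ R? onlyR) ⟩
      count Q? + count R?                     ∎
      where
      open ℕ.≤-Reasoning
      onlyR : P ∩ ∁ Q ⊆ R
      onlyR (Px , ¬Qx) with P⊆Q∪R Px
      ... | inj₁ Qx = contradiction Qx ¬Qx
      ... | inj₂ Rx = Rx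

    count-+-≤ : Q ⊆ P → R ⊆ P → Empty (Q ∩ R) → count Q? + count R? ≤ count P?
    count-+-≤ Q⊆P R⊆P Q∩R=∅ = begin
      count Q? + count R?                     ≤⟨ ℕ.+-mono-≤ (count-mono Q? _ λ Qx → Q⊆P Qx , Qx)
                                                             (count-mono R? _ λ Rx → R⊆P Rx , λ Qx → Q∩R=∅ _ (Qx , Rx)) ⟩
      count (P? ∩? Q?) + count (P? ∩? ∁? Q?)  ≡⟨ count-∩-∁ P? Q? ⟨
      count P?                                ∎
      where open ℕ.≤-Reasoning

  count-empty : {P : Pred (Fin n) ℓ} (P? : Decidable P) → Empty P → count P? ≡ 0
  count-empty P? ∅P = cong length (filter-none P? {xs = allFin n} (All.tabulate λ {i} _ → ∅P i))

  count-｛｝≤1 : (i : Fin n) → count (i Fin.≟_) ≤ 1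
  count-｛｝≤1 i = unique-constant⇒length≤1 (Unique.filter⁺ (i Fin.≟_) (Unique.allFin⁺ n))
                                          (All.map sym (all-filter (i Fin.≟_) (allFin n)))

  module _ {P : Pred (Fin n) ℓ} (P? : Decidable P) (f : Fin n → ℕ) where

    argmax-exists : Satisfiable P → ∃[ m ] P m × (∀ {j} → P j → f j ≤ f m)
    argmax-exists (i , Pi) = m , Extrema.argmax-all f Pi (all-filter P? (allFin n)) , maximal
      where
      m : Fin n
      m = Extrema.argmax f i (filter P? (allFin n))
      maximal : ∀ {j} → P j → f j ≤ f m
      maximal Pj = All.lookup (Extrema.f[xs]≤f[argmax] i (filter P? (allFin n)))
                              (∈-filter⁺ P? (∈-allFin _) Pj)

    argmin-exists : Satisfiable P → ∃[ m ] P m × (∀ {j} → P j → f m ≤ f j)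
    argmin-exists (i , Pi) = m , Extrema.argmin-all f Pi (all-filter P? (allFin n)) , minimal
      where
      m : Fin n
      m = Extrema.argmin f i (filter P? (allFin n))
      minimal : ∀ {j} → P j → f m ≤ f j
      minimal Pj = All.lookup (Extrema.f[argmin]≤f[xs] i (filter P? (allFin n)))
                              (∈-filter⁺ P? (∈-allFin _) Pj)

module Rank {n : ℕ} {_◁_ : Rel (Fin n) ℓ} (_◁?_ : B.Decidable _◁_)
            (◁-trans : Transitive _◁_) (◁-irrefl : Irreflexive _≡_ _◁_) where

  rank : Fin n → ℕ
  rank i = count (_◁? i)

  rank-mono : ∀ {i j} → j ◁ i → rank j ℕ.< rank i
  rank-mono {i} {j} j◁i = begin-strict
    rank j                     <⟨ ℕ.m<m+n (rank j) (filter-some (j Fin.≟_) (∈-allFin j)) ⟩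
    rank j + count (j Fin.≟_)  ≤⟨ count-+-≤ (_◁? i) (_◁? j) (j Fin.≟_) (λ x◁j → ◁-trans x◁j j◁i)
                                             (λ { refl → j◁i }) (λ x (x◁j , j≡x) → ◁-irrefl (sym j≡x) x◁j) ⟩
    rank i                     ∎
    where open ℕ.≤-Reasoning

  -- Take q below i in U with least rank: no element of U lies below q, and everything below q lies below i.
  +-count-below≤rank : {U : Pred (Fin n) ℓ₁} (U? : Decidable U) {c : ℤ} →
                       (∀ {j} → U j → c ℤ.≤ + rank j) →
                       ∀ {i} → U i → c ℤ.+ + count (U? ∩? (_◁? i)) ℤ.≤ + rank i
  +-count-below≤rank {U = U} U? {c} c≤rank {i} Ui = case Fin.any? S? of λ where
      (no ∄S)  → begin
        c ℤ.+ + count S?         ≡⟨ cong (λ m → c ℤ.+ + m) (count-empty S? λ j Sj → ∄S (j , Sj)) ⟩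
        c ℤ.+ + 0                ≡⟨ ℤ.+-identityʳ c ⟩
        c                        ≤⟨ c≤rank Ui ⟩
        + rank i                 ∎
      (yes ∃S) → let q , (Uq , q◁i) , q-least = argmin-exists S? rank ∃S in begin
        c ℤ.+ + count S?         ≤⟨ ℤ.+-monoˡ-≤ (+ count S?) (c≤rank Uq) ⟩
        + rank q ℤ.+ + count S?  ≡⟨ ℤ.pos-+ (rank q) (count S?) ⟨
        + (rank q + count S?)    ≤⟨ ℤ.+≤+ (count-+-≤ (_◁? i) (_◁? q) S? (λ j◁q → ◁-trans j◁q q◁i) proj₂
                                             λ j (j◁q , Sj) → ℕ.<⇒≱ (rank-mono j◁q) (q-least Sj)) ⟩
        + rank i                 ∎
    where
    open ℤ.≤-Reasoning
    S? : Decidable (U ∩ (_◁ i))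
    S? = U? ∩? (_◁? i)

module _ {n : ℕ} (π : Perm n) where

  -- Oriented so that the ranks of RightInversion π and LeftInversion π are r π and l π by definition.
  RightInversion LeftInversion : Rel (Fin n) 0ℓ
  RightInversion j i = i Fin.< j × π ⟨$⟩ʳ j Fin.< π ⟨$⟩ʳ i
  LeftInversion  j i = j Fin.< i × π ⟨$⟩ʳ i Fin.< π ⟨$⟩ʳ j

  rightInversion? : B.Decidable RightInversion
  rightInversion? j i = (i Fin.<? j) ×-dec (π ⟨$⟩ʳ j Fin.<? π ⟨$⟩ʳ i)

  leftInversion? : B.Decidable LeftInversion
  leftInversion? j i = (j Fin.<? i) ×-dec (π ⟨$⟩ʳ i Fin.<? π ⟨$⟩ʳ j)

  rightInversion-trans : Transitive RightInversion
  rightInversion-trans (y<x , πx<πy) (z<y , πy<πz) = Fin.<-trans z<y y<x , Fin.<-trans πx<πy πy<πz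

  leftInversion-trans : Transitive LeftInversion
  leftInversion-trans (x<y , πy<πx) (y<z , πz<πy) = Fin.<-trans x<y y<z , Fin.<-trans πz<πy πy<πx

  rightInversion-irrefl : Irreflexive _≡_ RightInversion
  rightInversion-irrefl refl (i<i , _) = Fin.<-irrefl refl i<i

  leftInversion-irrefl : Irreflexive _≡_ LeftInversion
  leftInversion-irrefl refl (i<i , _) = Fin.<-irrefl refl i<i

  module RightRank = Rank rightInversion? rightInversion-trans rightInversion-irrefl
  module LeftRank  = Rank leftInversion?  leftInversion-trans  leftInversion-irrefl

module _ {n : ℕ} {σ : Perm n} {U : Pred (Fin n) ℓ} {p : Fin n}
         (σ-max : ∀ {j} → U j → toℕ (σ ⟨$⟩ʳ j) ≤ toℕ (σ ⟨$⟩ʳ p)) where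

  σ-max-below : ∀ {j} → U j → j ≢ p → σ ⟨$⟩ʳ j Fin.< σ ⟨$⟩ʳ p
  σ-max-below Uj j≢p = Fin.≤∧≢⇒< (σ-max Uj) (j≢p ∘ Injection.injective (↔⇒↣ σ))

  σ-max-split : (τ : Perm n) → Avoids1212 σ τ →
                U ⊆ ｛ p ｝ ∪ ((U ∩ λ j → RightInversion σ j p) ∪ (U ∩ λ j → LeftInversion τ j p))
  σ-max-split τ avoid {j} Uj with Fin.<-cmp j p
  ... | tri≈ _ j≡p _ = inj₁ (sym j≡p)
  ... | tri> _ j≢p p<j = inj₂ (inj₁ (Uj , p<j , σ-max-below Uj j≢p))
  ... | tri< j<p j≢p _ = inj₂ (inj₂ (Uj , j<p , τp<τj))
    where
    τp<τj : τ ⟨$⟩ʳ p Fin.< τ ⟨$⟩ʳ j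
    τp<τj = Fin.≤∧≢⇒< (ℕ.≮⇒≥ λ τj<τp → avoid (j , p , j<p , σ-max-below Uj j≢p , τj<τp))
                      (j≢p ∘ sym ∘ Injection.injective (↔⇒↣ τ))

sum-of-excesses< : ∀ {a b x y : ℤ} {m₁ m₂ k : ℕ} → a ℤ.+ + m₁ ℤ.≤ x → b ℤ.+ + m₂ ℤ.≤ y →
             x ℤ.+ y ℤ.< a ℤ.+ b ℤ.+ + k → m₁ + m₂ ℕ.< k
sum-of-excesses< {a} {b} {x} {y} {m₁} {m₂} {k} am₁≤x bm₂≤y x+y<a+b+k =
  ℕ.≰⇒> λ k≤m₁+m₂ → ℤ.<⇒≱ x+y<a+b+k (begin
  a ℤ.+ b ℤ.+ + k                    ≤⟨ ℤ.+-monoʳ-≤ (a ℤ.+ b) (ℤ.+≤+ k≤m₁+m₂) ⟩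
  a ℤ.+ b ℤ.+ + (m₁ + m₂)            ≡⟨ cong (ℤ._+_ (a ℤ.+ b)) (ℤ.pos-+ m₁ m₂) ⟩
  a ℤ.+ b ℤ.+ (+ m₁ ℤ.+ + m₂)        ≡⟨ interchange a b (+ m₁) (+ m₂) ⟩
  (a ℤ.+ + m₁) ℤ.+ (b ℤ.+ + m₂)      ≤⟨ ℤ.+-mono-≤ am₁≤x bm₂≤y ⟩
  x ℤ.+ y                            ∎)
  where open ℤ.≤-Reasoning

module _ {n : ℕ} (σ τ : Perm n) (avoid : Avoids1212 σ τ) (k : ℕ) (a b : ℤ) where

  InTriangle : Pred (Fin n) 0ℓ
  InTriangle j = InShiftedT a b k (Γ σ τ j)

  inTriangle? : Decidable InTriangle
  inTriangle? j = inShiftedT? a b k (Γ σ τ j)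

  σ-max⇒count-inTriangle≤k : ∀ {p} → InTriangle p →
                             (∀ {j} → InTriangle j → toℕ (σ ⟨$⟩ʳ j) ≤ toℕ (σ ⟨$⟩ʳ p)) →
                             count inTriangle? ≤ k
  σ-max⇒count-inTriangle≤k {p} Tp σ-max = begin
    count inTriangle?                           ≤⟨ count-≤-+ inTriangle? (p Fin.≟_) (after ∪? before) split ⟩
    count (p Fin.≟_) + count (after ∪? before)  ≤⟨ ℕ.+-mono-≤ (count-｛｝≤1 p) (count-≤-+ _ after before id) ⟩
    1 + (count after + count before)            ≤⟨ sum-of-excesses< {a} {b} r-bound l-bound (proj₂ (proj₂ Tp)) ⟩
    k                                           ∎
    where
    open ℕ.≤-Reasoning
    After Before : Pred (Fin n) 0ℓ
    After  j = InTriangle j × RightInversion σ j p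
    Before j = InTriangle j × LeftInversion τ j p
    after : Decidable After
    after = inTriangle? ∩? λ j → rightInversion? σ j p
    before : Decidable Before
    before = inTriangle? ∩? λ j → leftInversion? τ j p
    split : InTriangle ⊆ ｛ p ｝ ∪ (After ∪ Before)
    split = σ-max-split {σ = σ} {p = p} σ-max τ avoid
    r-bound : a ℤ.+ + count after ℤ.≤ + r σ p
    r-bound = RightRank.+-count-below≤rank σ inTriangle? proj₁ Tp
    l-bound : b ℤ.+ + count before ℤ.≤ + l τ p
    l-bound = LeftRank.+-count-below≤rank τ inTriangle? (proj₁ ∘ proj₂) Tp

  count-inTriangle≤k : count inTriangle? ≤ k
  count-inTriangle≤k with Fin.any? inTriangle?
  ... | no ∄T = ℕ.≤-trans (ℕ.≤-reflexive (count-empty inTriangle? λ j Tj → ∄T (j , Tj))) z≤n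
  ... | yes ∃T with p , Tp , σ-max ← argmax-exists inTriangle? (toℕ ∘ (σ ⟨$⟩ʳ_)) ∃T =
    σ-max⇒count-inTriangle≤k Tp σ-max

mainTheorem2 : (n : ℕ) → 1 ≤ n → (σ τ : Perm n) → Avoids1212 σ τ → Sparse (Γ σ τ)
mainTheorem2 n _ σ τ avoid k _ _ a b =
  ℕ.≤-trans (count-mono _ (inTriangle? σ τ avoid k a b) proj₂) (count-inTriangle≤k σ τ avoid k a b)
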